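{- Let $A,B,C\in\mathbb{F}_2^{m\times m}$ with $t(A,B,C)=0$, and denote by $\mathbf{a}_k,\mathbf{b}_k,\mathbf{c}_k\in\mathbb{F}_2^{1\times m}$ the $k$-th rows of $A,B,C$ respectively. For nonnegative integers $i,j$ with $i+j\le m-1$ define the subspace $$V_{i,j}:=\langle \mathbf{a}_1,\dots,\mathbf{a}_i,\mathbf{b}_1,\dots,\mathbf{b}_{m-i-j-1},\mathbf{c}_1,\dots,\mathbf{c}_j\rangle\subseteq\mathbb{F}_2^{1\times m}.$$ Fix an integer $j$ with $0\le j\le m-1$. Then: (1) for every integer $1\le k\le m-j$ and all integers $0\le i_1<\dots<i_k\le m-1-j$, $\dim\bigcap_{l=1}^k V_{i_l,j}=m-k$; (2) $\left|\bigcap_{0\le i\le m-j-1} \left(\mathbb{F}_2^{1\times m}\setminus V_{i,j}\right)\right| = 2^j$.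
   Context: $\mathbb{F}_2=\{0,1\}$ is the field with two elements and $\mathbb{F}_2^{m\times m}$ the set of $m\times m$ matrices over $\mathbb{F}_2$. For $C_1,\dots,C_s\in\mathbb{F}_2^{m\times m}$, the digital net generated by $(C_1,\dots,C_s)$ is the point set $\{\mathbf{x}_0,\dots,\mathbf{x}_{2^m-1}\}\subset[0,1)^s$ defined as follows: for $0\le l<2^m$ write $l=\iota_0+\iota_1 2+\dots+\iota_{m-1}2^{m-1}$ with $\iota_k\in\mathbb{F}_2$, put $\mathbf{y}_{l,j}=C_j(\iota_0,\dots,\iota_{m-1})^\top\in\mathbb{F}_2^m$ and $\mathbf{x}_l=(\phi(\mathbf{y}_{l,1}),\dots,\phi(\mathbf{y}_{l,s}))$, where $\phi((y_1,\dots,y_m)^\top)=\sum_{k=1}^m y_k 2^{ -k}$. For $0\le t\le m$, a point set $\{\mathbf{x}_0,\dots,\mathbf{x}_{2^m-1}\}\subset[0,1)^s$ is a $(t,m,s)$-net over $\mathbb{F}_2$ if for all nonnegative integers $d_1,\dots,d_s$ with $d_1+\dots+d_s=m-t$, every elementary interval $\prod_{i=1}^s[a_i/2^{d_i},(a_i+1)/2^{d_i})$ with integers $0\le a_i<2^{d_i}$ contains exactly $2^t$ of the points (counted with multiplicity). $t(C_1,\dots,C_s)$ denotes the $t$-value of the digital net generated by $(C_1,\dots,C_s)$, i.e. the least $t$ for which it is a $(t,m,s)$-net over $\mathbb{F}_2$. $\langle\cdots\rangle$ denotes the $\mathbb{F}_2$-linear span. -}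

module Defs where

open import Data.Bool using (Bool; true; false; _∧_; _xor_; if_then_else_; T; not)
open import Data.Nat using (ℕ; zero; suc; _+_; _*_; _∸_; _^_; _≤_; _<_; _≤ᵇ_; _<ᵇ_)
open import Data.Fin using (Fin)
open import Data.Vec using (Vec; []; _∷_; lookup; toList; zipWith; replicate)
open import Data.List as List using (List; []; _∷_; upTo; allFin; map; take; length; _++_)
open import Data.Nat.ListAction using (sum)
open import Data.List.Relation.Unary.All using (All)
import Data.Vec as V
open import Data.Nat using (_%_; _/_; _≡ᵇ_)
open import Data.Bool using (_∨_)
import Data.List as L
open import Data.Product using (Σ; _×_; ∃)
open import Relation.Binary.PropositionalEquality using (_≡_)
open import Relation.Nullary using (¬_)

-- F₂ is modelled by Bool (false = 0, true = 1, addition = xor, product = ∧).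
𝔽₂ : Set
𝔽₂ = Bool

-- An m×m matrix over F₂, given as the vector of its m rows
-- (row k (0-based) is the (k+1)-th row of the paper).
Mat : ℕ → Set
Mat m = Vec (Vec 𝔽₂ m) m

RowVec : ℕ → Set
RowVec m = Vec 𝔽₂ m

zeroVec : ∀ {m} → RowVec m
zeroVec = replicate _ false

_⊕_ : ∀ {m} → RowVec m → RowVec m → RowVec m
_⊕_ = zipWith _xor_

scale : ∀ {m} → 𝔽₂ → RowVec m → RowVec m
scale c v = V.map (c ∧_) v

dot : ∀ {m} → Vec 𝔽₂ m → Vec 𝔽₂ m → 𝔽₂
dot [] [] = false
dot (x ∷ xs) (y ∷ ys) = (x ∧ y) xor dot xs ys

-- digits ι₀,…,ι_{m-1} of l (least significant first)
bits : (m : ℕ) → ℕ → Vec 𝔽₂ m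
bits zero l = []
bits (suc m) l = (l % 2 ≡ᵇ 1) ∷ bits m (l / 2)

matVec : ∀ {m} → Mat m → Vec 𝔽₂ m → Vec 𝔽₂ m
matVec rows v = V.map (λ r → dot r v) rows

-- 2^m · φ(y) for y ∈ F₂^m, i.e. Σ_{k=1}^m y_k 2^{m-k} (an exact natural number)
scaledφ : ∀ {m} → Vec 𝔽₂ m → ℕ
scaledφ [] = 0
scaledφ {suc m} (b ∷ ys) = (if b then 2 ^ m else 0) + scaledφ ys

-- 2^m times the i-th coordinate of the point x_l of the digital net generated by Cs
scaledPoint : ∀ {m s} → Vec (Mat m) s → ℕ → Fin s → ℕ
scaledPoint {m} Cs l i = scaledφ (matVec (lookup Cs i) (bits m l))

countᵇ : {A : Set} → (A → Bool) → List A → ℕ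
countᵇ p xs = sum (map (λ x → if p x then 1 else 0) xs)

-- x ∈ [a/2^d, (a+1)/2^d) where x = N / 2^m, i.e. a·2^{m-d} ≤ N < (a+1)·2^{m-d}  (d ≤ m)
inDyadicᵇ : (m d a N : ℕ) → Bool
inDyadicᵇ m d a N = (a * 2 ^ (m ∸ d) ≤ᵇ N) ∧ (N <ᵇ (suc a) * 2 ^ (m ∸ d))

allᵇ : {A : Set} → (A → Bool) → List A → Bool
allᵇ p xs = L.foldr (λ x b → p x ∧ b) true xs

anyᵇ : {A : Set} → (A → Bool) → List A → Bool
anyᵇ p xs = L.foldr (λ x b → p x ∨ b) false xs

-- number of points x_l (0 ≤ l < 2^m, with multiplicity) in the elementary interval
-- ∏_i [a_i/2^{d_i}, (a_i+1)/2^{d_i})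
pointsInBox : ∀ {m s} → Vec (Mat m) s → (Fin s → ℕ) → (Fin s → ℕ) → ℕ
pointsInBox {m} {s} Cs ds as =
  countᵇ (λ l → allᵇ (λ i → inDyadicᵇ m (ds i) (as i) (scaledPoint Cs l i)) (allFin s))
         (upTo (2 ^ m))

sumFin : ∀ {s} → (Fin s → ℕ) → ℕ
sumFin {s} f = sum (map f (allFin s))

IsNet : ∀ {m s} → Vec (Mat m) s → ℕ → Set
IsNet {m} {s} Cs t =
  t ≤ m ×
  ((ds : Fin s → ℕ) → sumFin ds ≡ m ∸ t →
   (as : Fin s → ℕ) → (∀ i → as i < 2 ^ ds i) →
   pointsInBox Cs ds as ≡ 2 ^ t)

TValue : ∀ {m s} → Vec (Mat m) s → ℕ → Set
TValue Cs t = IsNet Cs t × (∀ t' → t' < t → ¬ IsNet Cs t')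

lincomb : ∀ {m} → (L : List (RowVec m)) → Vec 𝔽₂ (length L) → RowVec m
lincomb [] [] = zeroVec
lincomb (v ∷ L) (c ∷ cs) = scale c v ⊕ lincomb L cs

InSpan : ∀ {m} → List (RowVec m) → RowVec m → Set
InSpan L v = ∃ λ (cs : Vec 𝔽₂ (length L)) → lincomb L cs ≡ v

allVecs : (n : ℕ) → List (Vec 𝔽₂ n)
allVecs zero = [] ∷ []
allVecs (suc n) = map (false ∷_) (allVecs n) ++ map (true ∷_) (allVecs n)

eqVecᵇ : ∀ {n} → Vec 𝔽₂ n → Vec 𝔽₂ n → Bool
eqVecᵇ [] [] = true
eqVecᵇ (x ∷ xs) (y ∷ ys) = not (x xor y) ∧ eqVecᵇ xs ys

inSpanᵇ : ∀ {m} → List (RowVec m) → RowVec m → Bool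
inSpanᵇ L v = anyᵇ (λ cs → eqVecᵇ (lincomb L cs) v) (allVecs (length L))

LinIndep : ∀ {m} → List (RowVec m) → Set
LinIndep L = ∀ (cs : Vec 𝔽₂ (length L)) → lincomb L cs ≡ zeroVec → cs ≡ replicate _ false

HasDim : ∀ {m} → (RowVec m → Set) → ℕ → Set
HasDim {m} P d = Σ (List (RowVec m)) λ bs →
  length bs ≡ d × All P bs × LinIndep bs × (∀ v → P v → InSpan bs v)

firstRows : ∀ {m} → Mat m → ℕ → List (RowVec m)
firstRows M n = take n (toList M)

Vgens : ∀ {m} → Mat m → Mat m → Mat m → ℕ → ℕ → List (RowVec m)
Vgens {m} A B C i j = firstRows A i ++ firstRows B (m ∸ i ∸ j ∸ 1) ++ firstRows C j

{-# OPTIONS --safe #-}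
module Submission where

open import Defs
open import Data.Nat using (ℕ; _+_; _∸_; _^_; _≤_; _<_; suc)
open import Data.Fin using (Fin)
open import Data.Vec using (Vec; []; _∷_)
open import Data.List using (upTo)
open import Data.Bool using (not)
open import Data.Product using (_×_)
open import Relation.Binary.PropositionalEquality using (_≡_)

open import Algebra.Bundles using (CommutativeRing)
open import Data.Bool using (Bool; true; false; _∧_; _xor_; T; if_then_else_)
import Data.Bool.Properties as BP
open import Data.Fin as F using (zero; suc)
open import Data.List as L using (List; []; _∷_; _++_; length; take; drop)
import Data.List.Properties as LP
open import Data.List.Membership.Propositional using (_∈_; find)
open import Data.List.Membership.Propositional.Properties using (∈-map⁺; ∈-++⁺ˡ; ∈-++⁺ʳ; ∈-∃++; ∈-upTo⁺)
open import Data.List.Relation.Unary.All as All using (All; []; _∷_)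
import Data.List.Relation.Unary.All.Properties as AllP
open import Data.List.Relation.Unary.AllPairs using (AllPairs; []; _∷_)
import Data.List.Relation.Unary.AllPairs.Properties as AllPairsP
open import Data.List.Relation.Unary.Any as Any using (Any; here; there; any?)
open import Data.Nat using (zero; _*_; z≤n; s≤s; _≡ᵇ_)
open import Data.Nat.DivMod using ([m+kn]%n≡m%n; m*n/n≡m; +-distrib-/-∣ʳ)
open import Data.Nat.Divisibility using (divides)
open import Data.Nat.ListAction using (sum)
open import Data.Nat.ListAction.Properties using (sum-++)
open import Data.Nat.Properties
open import Data.Product using (∃; _,_; proj₁; proj₂)
open import Data.Sum using (inj₁; inj₂; [_,_]′)
open import Data.Unit using (⊤; tt)
open import Data.Vec as V using ()
import Data.Vec.Properties as VP
import Data.Vec.Relation.Binary.Equality.Cast as Cast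
open import Function using (_∘_; id)
open import Function.Bundles using (_⇔_; mk⇔; Equivalence)
open import Function.Construct.Composition using (_⇔-∘_)
open import Function.Definitions using (Bijective)
open import Relation.Binary.PropositionalEquality using (_≢_; refl; sym; trans; cong; cong₂; subst; module ≡-Reasoning)
open import Relation.Nullary using (yes; no; contradiction)
open import Algebra.Properties.CommutativeSemigroup (CommutativeRing.+-commutativeSemigroup BP.xor-∧-commutativeRing)
  using (interchange; x∙yz≈y∙xz)
open import Algebra.Properties.CommutativeSemigroup +-commutativeSemigroup
  using () renaming (x∙yz≈y∙xz to +-left-comm; interchange to +-interchange)

-- For d₁ + d₂ + d₃ = m, the (0,m,3)-net property puts exactly one point into every elementary
-- box with side lengths 2^-d₁, 2^-d₂, 2^-d₃; that is, ι ↦ (leading d₁ digits of Aι, leading d₂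
-- digits of Bι, leading d₃ digits of Cι) is a bijection of F₂^m, so the first d₁ rows of A,
-- d₂ rows of B and d₃ rows of C form a basis. For (d₁,d₂,d₃) = (i+1, m-i-j-1, j), V_{i,j} is
-- this basis with a_{i+1} removed, hence a hyperplane w_i^⊥ with a_{i+1}·w_i = 1, while
-- a_{p+1} ∈ V_{i,j} for p < i.
-- (1) Intersect the hyperplanes starting from the smallest index i₁: a_{i₁+1} lies in all the
--     later ones but not in V_{i₁,j}, so every step lowers the dimension by exactly one.
-- (2) Translation by a_{i+1} exchanges the two sides of V_{i,j} and preserves each V_{k,j} with
--     k > i, so each of the m-j conditions v ∉ V_{i,j} halves the count, leaving 2^m / 2^(m-j).

⊕-identityˡ : ∀ {m} (x : RowVec m) → zeroVec ⊕ x ≡ x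
⊕-identityˡ = VP.zipWith-identityˡ BP.xor-identityˡ

⊕-identityʳ : ∀ {m} (x : RowVec m) → x ⊕ zeroVec ≡ x
⊕-identityʳ = VP.zipWith-identityʳ BP.xor-identityʳ

⊕-self : ∀ {m} (x : RowVec m) → x ⊕ x ≡ zeroVec
⊕-self [] = refl
⊕-self (a ∷ x) = cong₂ _∷_ (BP.xor-same a) (⊕-self x)

⊕-interchange : ∀ {m} (x y z u : RowVec m) → (x ⊕ y) ⊕ (z ⊕ u) ≡ (x ⊕ z) ⊕ (y ⊕ u)
⊕-interchange [] [] [] [] = refl
⊕-interchange (a ∷ x) (b ∷ y) (c ∷ z) (d ∷ u) = cong₂ _∷_ (interchange a b c d) (⊕-interchange x y z u)

⊕-left-comm : ∀ {m} (x y z : RowVec m) → x ⊕ (y ⊕ z) ≡ y ⊕ (x ⊕ z)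
⊕-left-comm [] [] [] = refl
⊕-left-comm (a ∷ x) (b ∷ y) (c ∷ z) = cong₂ _∷_ (x∙yz≈y∙xz a b c) (⊕-left-comm x y z)

scale-true : ∀ {m} (x : RowVec m) → scale true x ≡ x
scale-true = VP.map-id

scale-false : ∀ {m} (x : RowVec m) → scale false x ≡ zeroVec
scale-false x = VP.map-const x false

scale-zero : ∀ {m} c → scale c (zeroVec {m}) ≡ zeroVec
scale-zero {m} c = trans (VP.map-replicate (c ∧_) false m) (cong (V.replicate m) (BP.∧-zeroʳ c))

scale-distrib-⊕ : ∀ {m} c (x y : RowVec m) → scale c (x ⊕ y) ≡ scale c x ⊕ scale c y
scale-distrib-⊕ c [] [] = refl
scale-distrib-⊕ c (a ∷ x) (b ∷ y) = cong₂ _∷_ (BP.∧-distribˡ-xor c a b) (scale-distrib-⊕ c x y)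

scale-distrib-xor : ∀ {m} p q (x : RowVec m) → scale (p xor q) x ≡ scale p x ⊕ scale q x
scale-distrib-xor p q [] = refl
scale-distrib-xor p q (a ∷ x) = cong₂ _∷_ (BP.∧-distribʳ-xor a p q) (scale-distrib-xor p q x)

scale-∧ : ∀ {m} p q (x : RowVec m) → scale (p ∧ q) x ≡ scale p (scale q x)
scale-∧ p q x = trans (VP.map-cong (BP.∧-assoc p q) x) (VP.map-∘ (p ∧_) (q ∧_) x)

dot-distribʳ-⊕ : ∀ {m} (x y z : RowVec m) → dot (x ⊕ y) z ≡ dot x z xor dot y z
dot-distribʳ-⊕ [] [] [] = refl
dot-distribʳ-⊕ (a ∷ x) (b ∷ y) (c ∷ z) = begin
  ((a xor b) ∧ c) xor dot (x ⊕ y) z       ≡⟨ cong₂ _xor_ (BP.∧-distribʳ-xor c a b) (dot-distribʳ-⊕ x y z) ⟩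
  ((a ∧ c) xor (b ∧ c)) xor (dot x z xor dot y z) ≡⟨ interchange (a ∧ c) (b ∧ c) (dot x z) (dot y z) ⟩
  ((a ∧ c) xor dot x z) xor ((b ∧ c) xor dot y z) ∎
  where
  open ≡-Reasoning

dot-scaleˡ : ∀ {m} c (x z : RowVec m) → dot (scale c x) z ≡ c ∧ dot x z
dot-scaleˡ c [] [] = sym (BP.∧-zeroʳ c)
dot-scaleˡ c (a ∷ x) (b ∷ z) = begin
  ((c ∧ a) ∧ b) xor dot (scale c x) z ≡⟨ cong₂ _xor_ (BP.∧-assoc c a b) (dot-scaleˡ c x z) ⟩
  (c ∧ (a ∧ b)) xor (c ∧ dot x z)     ≡⟨ sym (BP.∧-distribˡ-xor c (a ∧ b) (dot x z)) ⟩
  c ∧ ((a ∧ b) xor dot x z)           ∎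
  where open ≡-Reasoning

dot-zeroˡ : ∀ {m} (z : RowVec m) → dot zeroVec z ≡ false
dot-zeroˡ [] = refl
dot-zeroˡ (b ∷ z) = dot-zeroˡ z

dot-comm : ∀ {m} (x y : RowVec m) → dot x y ≡ dot y x
dot-comm [] [] = refl
dot-comm (a ∷ x) (b ∷ y) = cong₂ _xor_ (BP.∧-comm a b) (dot-comm x y)

dot-zeroʳ : ∀ {m} (z : RowVec m) → dot z zeroVec ≡ false
dot-zeroʳ z = trans (dot-comm z zeroVec) (dot-zeroˡ z)

dot-scale-⊕ : ∀ {m} c (x y z : RowVec m) → dot (scale c x ⊕ y) z ≡ (c ∧ dot x z) xor dot y z
dot-scale-⊕ c x y z = trans (dot-distribʳ-⊕ (scale c x) y z) (cong (_xor dot y z) (dot-scaleˡ c x z))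

xor-false⇒≡ : ∀ {c d} → c xor d ≡ false → d ≡ c
xor-false⇒≡ {c} {d} c+d≡0 = begin
  d                 ≡⟨ cong (_xor d) (BP.xor-same c) ⟨
  (c xor c) xor d   ≡⟨ BP.xor-assoc c c d ⟩
  c xor (c xor d)   ≡⟨ cong (c xor_) c+d≡0 ⟩
  c xor false       ≡⟨ BP.xor-identityʳ c ⟩
  c                 ∎
  where open ≡-Reasoning

unit : ∀ {n} → Fin n → Vec 𝔽₂ n
unit {suc n} zero = true ∷ zeroVec
unit (suc s) = false ∷ unit s

dot-unitʳ : ∀ {n} (y : Vec 𝔽₂ n) s → dot y (unit s) ≡ V.lookup y s
dot-unitʳ (y ∷ ys) zero = trans (cong ((y ∧ true) xor_) (dot-zeroʳ ys)) (trans (BP.xor-identityʳ _) (BP.∧-identityʳ y))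
dot-unitʳ (y ∷ ys) (suc s) = trans (cong (_xor dot ys (unit s)) (BP.∧-zeroʳ y)) (dot-unitʳ ys s)

≡-by-lookup : ∀ {A : Set} {n} {x y : Vec A n} → (∀ s → V.lookup x s ≡ V.lookup y s) → x ≡ y
≡-by-lookup {x = x} {y} h = trans (sym (VP.tabulate∘lookup x)) (trans (VP.tabulate-cong h) (VP.tabulate∘lookup y))

≡-by-dot : ∀ {m} (x y : RowVec m) → (∀ ι → dot x ι ≡ dot y ι) → x ≡ y
≡-by-dot x y h = ≡-by-lookup λ s → trans (sym (dot-unitʳ x s)) (trans (h (unit s)) (dot-unitʳ y s))

lookup-unit-comm : ∀ {n} (s t : Fin n) → V.lookup (unit s) t ≡ V.lookup (unit t) s
lookup-unit-comm zero zero = refl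
lookup-unit-comm zero (suc t) = VP.lookup-replicate t false
lookup-unit-comm (suc s) zero = sym (VP.lookup-replicate s false)
lookup-unit-comm (suc s) (suc t) = lookup-unit-comm s t

lookup-unit-self : ∀ {n} (s : Fin n) → V.lookup (unit s) s ≡ true
lookup-unit-self zero = refl
lookup-unit-self (suc s) = lookup-unit-self s

combination : ∀ {m K} → Vec (RowVec m) K → Vec 𝔽₂ K → RowVec m
combination [] [] = zeroVec
combination (e ∷ E) (c ∷ cs) = scale c e ⊕ combination E cs

lincomb≡combination : ∀ {m} (L : List (RowVec m)) cs → lincomb L cs ≡ combination (V.fromList L) cs
lincomb≡combination [] [] = refl
lincomb≡combination (e ∷ L) (c ∷ cs) = cong (scale c e ⊕_) (lincomb≡combination L cs)

evaluation : ∀ {m K} → Vec (RowVec m) K → RowVec m → Vec 𝔽₂ K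
evaluation E ι = V.map (λ e → dot e ι) E

dot-combination : ∀ {m K} (E : Vec (RowVec m) K) cs ι → dot (combination E cs) ι ≡ dot cs (evaluation E ι)
dot-combination [] [] ι = dot-zeroˡ ι
dot-combination (e ∷ E) (c ∷ cs) ι = begin
  dot (scale c e ⊕ combination E cs) ι         ≡⟨ dot-distribʳ-⊕ (scale c e) (combination E cs) ι ⟩
  dot (scale c e) ι xor dot (combination E cs) ι ≡⟨ cong₂ _xor_ (dot-scaleˡ c e ι) (dot-combination E cs ι) ⟩
  (c ∧ dot e ι) xor dot cs (evaluation E ι)    ∎
  where open ≡-Reasoning

lincomb-replicate-false : ∀ {m} (L : List (RowVec m)) → lincomb L (V.replicate _ false) ≡ zeroVec
lincomb-replicate-false [] = refl
lincomb-replicate-false (e ∷ L) = trans (cong₂ _⊕_ (scale-false e) (lincomb-replicate-false L)) (⊕-identityˡ zeroVec)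

∈⇒InSpan : ∀ {m} {L : List (RowVec m)} {x} → x ∈ L → InSpan L x
∈⇒InSpan {L = x ∷ L} (here refl) =
  true ∷ V.replicate _ false , trans (cong₂ _⊕_ (scale-true x) (lincomb-replicate-false L)) (⊕-identityʳ x)
∈⇒InSpan {L = e ∷ L} (there x∈L) with ∈⇒InSpan x∈L
... | cs , refl = false ∷ cs , trans (cong (_⊕ lincomb L cs) (scale-false e)) (⊕-identityˡ _)

IsLinear : ∀ {m n} → (RowVec m → RowVec n) → Set
IsLinear f = ∀ c x y → f (scale c x ⊕ y) ≡ scale c (f x) ⊕ f y

linear-zero : ∀ {m n} {f : RowVec m → RowVec n} → IsLinear f → f zeroVec ≡ zeroVec
linear-zero {f = f} lin = begin
  f zeroVec                         ≡⟨ cong f (⊕-self zeroVec) ⟨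
  f (zeroVec ⊕ zeroVec)             ≡⟨ cong (λ z → f (z ⊕ zeroVec)) (scale-true zeroVec) ⟨
  f (scale true zeroVec ⊕ zeroVec)  ≡⟨ lin true zeroVec zeroVec ⟩
  scale true (f zeroVec) ⊕ f zeroVec ≡⟨ cong (_⊕ f zeroVec) (scale-true (f zeroVec)) ⟩
  f zeroVec ⊕ f zeroVec             ≡⟨ ⊕-self (f zeroVec) ⟩
  zeroVec                           ∎
  where open ≡-Reasoning

cast-replicate : ∀ {A : Set} {m n} .(eq : m ≡ n) (x : A) → V.cast eq (V.replicate m x) ≡ V.replicate n x
cast-replicate {m = zero} {zero} eq x = refl
cast-replicate {m = suc m} {suc n} eq x = cong (x ∷_) (cast-replicate (suc-injective eq) x)

cast≡replicate⇒≡replicate : ∀ {A : Set} {m n} .(eq : m ≡ n) {x : A} (xs : Vec A m) →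
                            V.cast eq xs ≡ V.replicate n x → xs ≡ V.replicate m x
cast≡replicate⇒≡replicate eq {x} xs eq-rep = trans (sym (VP.cast-sym eq eq-rep)) (cast-replicate (sym eq) x)

lincomb-map : ∀ {m n} {f : RowVec m → RowVec n} → IsLinear f → (L : List (RowVec m)) → ∀ cs →
              lincomb (L.map f L) cs ≡ f (lincomb L (V.cast (LP.length-map f L) cs))
lincomb-map lin [] [] = sym (linear-zero lin)
lincomb-map {f = f} lin (e ∷ L) (c ∷ cs) =
  trans (cong (scale c (f e) ⊕_) (lincomb-map lin L cs)) (sym (lin c e _))

-- Hyperplanes spanned by a basis minus one vector

module DualBasis {m K} (E : Vec (RowVec m) K) (bij : Bijective _≡_ _≡_ (evaluation E)) where

  dual : Fin K → RowVec m
  dual s = proj₁ (proj₂ bij (unit s))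

  evaluation-dual : ∀ s → evaluation E (dual s) ≡ unit s
  evaluation-dual s = proj₂ (proj₂ bij (unit s)) refl

  D : Vec (RowVec m) K
  D = V.tabulate dual

  evaluation-dual-transpose : ∀ t → evaluation D (V.lookup E t) ≡ unit t
  evaluation-dual-transpose t = ≡-by-lookup λ s → begin
    V.lookup (evaluation D (V.lookup E t)) s ≡⟨ VP.lookup-map s _ D ⟩
    dot (V.lookup D s) (V.lookup E t)       ≡⟨ cong (λ d → dot d (V.lookup E t)) (VP.lookup∘tabulate dual s) ⟩
    dot (dual s) (V.lookup E t)             ≡⟨ dot-comm (dual s) (V.lookup E t) ⟩
    dot (V.lookup E t) (dual s)             ≡⟨ VP.lookup-map t _ E ⟨
    V.lookup (evaluation E (dual s)) t      ≡⟨ cong (λ y → V.lookup y t) (evaluation-dual s) ⟩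
    V.lookup (unit s) t                     ≡⟨ lookup-unit-comm s t ⟩
    V.lookup (unit t) s                     ∎
    where open ≡-Reasoning

  evaluation-combination-dual : ∀ y → evaluation E (combination D y) ≡ y
  evaluation-combination-dual y = ≡-by-lookup λ t → begin
    V.lookup (evaluation E (combination D y)) t ≡⟨ VP.lookup-map t _ E ⟩
    dot (V.lookup E t) (combination D y)        ≡⟨ dot-comm (V.lookup E t) (combination D y) ⟩
    dot (combination D y) (V.lookup E t)        ≡⟨ dot-combination D y (V.lookup E t) ⟩
    dot y (evaluation D (V.lookup E t))         ≡⟨ cong (dot y) (evaluation-dual-transpose t) ⟩
    dot y (unit t)                              ≡⟨ dot-unitʳ y t ⟩
    V.lookup y t                                ∎
    where open ≡-Reasoning

  combination-dual-evaluation : ∀ ι → combination D (evaluation E ι) ≡ ι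
  combination-dual-evaluation ι = proj₁ bij (evaluation-combination-dual (evaluation E ι))

  combination-evaluation-dual : ∀ v → combination E (evaluation D v) ≡ v
  combination-evaluation-dual v = ≡-by-dot _ v λ ι → begin
    dot (combination E (evaluation D v)) ι      ≡⟨ dot-combination E (evaluation D v) ι ⟩
    dot (evaluation D v) (evaluation E ι)       ≡⟨ dot-comm (evaluation D v) (evaluation E ι) ⟩
    dot (evaluation E ι) (evaluation D v)       ≡⟨ dot-combination D (evaluation E ι) v ⟨
    dot (combination D (evaluation E ι)) v      ≡⟨ cong (λ u → dot u v) (combination-dual-evaluation ι) ⟩
    dot ι v                                     ≡⟨ dot-comm ι v ⟩
    dot v ι                                     ∎
    where open ≡-Reasoning

module Insertion {m} (a : RowVec m) (Y : List (RowVec m)) where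

  position : (X : List (RowVec m)) → Fin (length (X ++ a ∷ Y))
  position [] = zero
  position (x ∷ X) = suc (position X)

  insert : (X : List (RowVec m)) → Vec 𝔽₂ (length (X ++ Y)) → 𝔽₂ → Vec 𝔽₂ (length (X ++ a ∷ Y))
  insert [] cs c = c ∷ cs
  insert (x ∷ X) (c′ ∷ cs) c = c′ ∷ insert X cs c

  remove : (X : List (RowVec m)) → Vec 𝔽₂ (length (X ++ a ∷ Y)) → Vec 𝔽₂ (length (X ++ Y))
  remove [] (c ∷ cs) = cs
  remove (x ∷ X) (c′ ∷ cs) = c′ ∷ remove X cs

  lookup-position : (X : List (RowVec m)) → V.lookup (V.fromList (X ++ a ∷ Y)) (position X) ≡ a
  lookup-position [] = refl
  lookup-position (x ∷ X) = lookup-position X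

  lookup-insert : (X : List (RowVec m)) → ∀ cs c → V.lookup (insert X cs c) (position X) ≡ c
  lookup-insert [] cs c = refl
  lookup-insert (x ∷ X) (c′ ∷ cs) c = lookup-insert X cs c

  insert-remove : (X : List (RowVec m)) → ∀ cs → insert X (remove X cs) (V.lookup cs (position X)) ≡ cs
  insert-remove [] (c ∷ cs) = refl
  insert-remove (x ∷ X) (c′ ∷ cs) = cong (c′ ∷_) (insert-remove X cs)

  remove-insert : (X : List (RowVec m)) → ∀ cs c → remove X (insert X cs c) ≡ cs
  remove-insert [] cs c = refl
  remove-insert (x ∷ X) (c′ ∷ cs) c = cong (c′ ∷_) (remove-insert X cs c)

  remove-replicate : (X : List (RowVec m)) → remove X (V.replicate _ false) ≡ V.replicate _ false
  remove-replicate [] = refl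
  remove-replicate (x ∷ X) = cong (false ∷_) (remove-replicate X)

  lincomb-insert : (X : List (RowVec m)) → ∀ cs c → lincomb (X ++ a ∷ Y) (insert X cs c) ≡ scale c a ⊕ lincomb (X ++ Y) cs
  lincomb-insert [] cs c = refl
  lincomb-insert (x ∷ X) (c′ ∷ cs) c =
    trans (cong (scale c′ x ⊕_) (lincomb-insert X cs c)) (⊕-left-comm (scale c′ x) (scale c a) _)

  lincomb-insert-false : (X : List (RowVec m)) → ∀ cs → lincomb (X ++ a ∷ Y) (insert X cs false) ≡ lincomb (X ++ Y) cs
  lincomb-insert-false X cs =
    trans (lincomb-insert X cs false) (trans (cong (_⊕ lincomb (X ++ Y) cs) (scale-false a)) (⊕-identityˡ _))

SpanIsHyperplane : ∀ {m} → List (RowVec m) → RowVec m → Set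
SpanIsHyperplane L w = ∀ v → InSpan L v ⇔ dot v w ≡ false

basis-without-one-spans-hyperplane : ∀ {m} (X : List (RowVec m)) a Y →
  Bijective _≡_ _≡_ (evaluation (V.fromList (X ++ a ∷ Y))) →
  ∃ λ w → SpanIsHyperplane (X ++ Y) w × dot a w ≡ true
basis-without-one-spans-hyperplane {m} X a Y bij = w , (λ v → mk⇔ (span⇒⊥ v) (⊥⇒span v)) , dot-a-w
  where
  open Insertion a Y
  E : Vec (RowVec m) (length (X ++ a ∷ Y))
  E = V.fromList (X ++ a ∷ Y)
  open DualBasis E bij
  p : Fin (length (X ++ a ∷ Y))
  p = position X
  w : RowVec m
  w = dual p

  dot-lincomb-w : ∀ cs → dot (lincomb (X ++ a ∷ Y) cs) w ≡ V.lookup cs p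
  dot-lincomb-w cs = begin
    dot (lincomb (X ++ a ∷ Y) cs) w ≡⟨ cong (λ u → dot u w) (lincomb≡combination (X ++ a ∷ Y) cs) ⟩
    dot (combination E cs) w        ≡⟨ dot-combination E cs w ⟩
    dot cs (evaluation E w)         ≡⟨ cong (dot cs) (evaluation-dual p) ⟩
    dot cs (unit p)                 ≡⟨ dot-unitʳ cs p ⟩
    V.lookup cs p                   ∎
    where open ≡-Reasoning

  span⇒⊥ : ∀ v → InSpan (X ++ Y) v → dot v w ≡ false
  span⇒⊥ v (cs , refl) = begin
    dot (lincomb (X ++ Y) cs) w                    ≡⟨ cong (λ u → dot u w) (lincomb-insert-false X cs) ⟨
    dot (lincomb (X ++ a ∷ Y) (insert X cs false)) w ≡⟨ dot-lincomb-w (insert X cs false) ⟩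
    V.lookup (insert X cs false) p                 ≡⟨ lookup-insert X cs false ⟩
    false                                          ∎
    where open ≡-Reasoning

  ⊥⇒span : ∀ v → dot v w ≡ false → InSpan (X ++ Y) v
  ⊥⇒span v v⊥w = remove X cs , (begin
    lincomb (X ++ Y) (remove X cs)                           ≡⟨ lincomb-insert-false X (remove X cs) ⟨
    lincomb (X ++ a ∷ Y) (insert X (remove X cs) false)      ≡⟨ cong (lincomb (X ++ a ∷ Y) ∘ insert X (remove X cs)) cs-p ⟨
    lincomb (X ++ a ∷ Y) (insert X (remove X cs) (V.lookup cs p)) ≡⟨ cong (lincomb (X ++ a ∷ Y)) (insert-remove X cs) ⟩
    lincomb (X ++ a ∷ Y) cs                                  ≡⟨ lincomb≡combination (X ++ a ∷ Y) cs ⟩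
    combination E cs                                         ≡⟨ combination-evaluation-dual v ⟩
    v                                                        ∎)
    where
    open ≡-Reasoning
    cs : Vec 𝔽₂ (length (X ++ a ∷ Y))
    cs = evaluation D v
    cs-p : V.lookup cs p ≡ false
    cs-p = begin
      V.lookup cs p ≡⟨ VP.lookup-map p _ D ⟩
      dot (V.lookup D p) v ≡⟨ cong (λ d → dot d v) (VP.lookup∘tabulate dual p) ⟩
      dot w v ≡⟨ dot-comm w v ⟩
      dot v w ≡⟨ v⊥w ⟩
      false ∎

  dot-a-w : dot a w ≡ true
  dot-a-w = begin
    dot a w                  ≡⟨ cong (λ u → dot u w) (lookup-position X) ⟨
    dot (V.lookup E p) w     ≡⟨ VP.lookup-map p _ E ⟨
    V.lookup (evaluation E w) p ≡⟨ cong (λ y → V.lookup y p) (evaluation-dual p) ⟩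
    V.lookup (unit p) p      ≡⟨ lookup-unit-self p ⟩
    true                     ∎
    where open ≡-Reasoning

IsLinearlyClosed : ∀ {m} → (RowVec m → Set) → Set
IsLinearlyClosed {m} P = ∀ c (x y : RowVec m) → P x → P y → P (scale c x ⊕ y)

kernel-closed : ∀ {m} (w : RowVec m) → IsLinearlyClosed (λ v → dot v w ≡ false)
kernel-closed w c x y x·w y·w =
  trans (dot-scale-⊕ c x y w) (trans (cong₂ (λ p q → (c ∧ p) xor q) x·w y·w) (cong (_xor false) (BP.∧-zeroʳ c)))

hyperplane-closed : ∀ {m} (L : List (RowVec m)) {w} → SpanIsHyperplane L w → IsLinearlyClosed (InSpan L)
hyperplane-closed L {w} L≡w⊥ c x y x∈L y∈L =
  from (L≡w⊥ _) (kernel-closed w c x y (to (L≡w⊥ x) x∈L) (to (L≡w⊥ y) y∈L))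
  where open Equivalence

HasDim-resp : ∀ {m} {P Q : RowVec m → Set} {d} → (∀ v → P v ⇔ Q v) → HasDim P d → HasDim Q d
HasDim-resp P⇔Q (bs , len , allP , indep , spans) =
  bs , len , All.map (Equivalence.to (P⇔Q _)) allP , indep , λ v q → spans v (Equivalence.from (P⇔Q v) q)

span-⊥ : ∀ {m} {L : List (RowVec m)} {w} → All (λ g → dot g w ≡ false) L → ∀ v → InSpan L v → dot v w ≡ false
span-⊥ {w = w} [] v ([] , refl) = dot-zeroˡ w
span-⊥ {L = g ∷ L} {w} (g⊥w ∷ L⊥w) v (c ∷ cs , refl) = begin
  dot (scale c g ⊕ lincomb L cs) w       ≡⟨ dot-scale-⊕ c g (lincomb L cs) w ⟩
  (c ∧ dot g w) xor dot (lincomb L cs) w ≡⟨ cong₂ (λ p q → (c ∧ p) xor q) g⊥w (span-⊥ L⊥w _ (cs , refl)) ⟩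
  (c ∧ false) xor false                  ≡⟨ cong (_xor false) (BP.∧-zeroʳ c) ⟩
  false                                  ∎
  where open ≡-Reasoning

generator-not-⊥ : ∀ {m} {L : List (RowVec m)} {v w} → InSpan L v → dot v w ≡ true → ∃ λ b → b ∈ L × dot b w ≡ true
generator-not-⊥ {L = L} {v} {w} v∈L v·w with any? (λ b → dot b w BP.≟ true) L
... | yes some = find some
... | no none with () ← trans (sym v·w) (span-⊥ (All.map BP.¬-not (AllP.¬Any⇒All¬ L none)) v v∈L)

transvection : ∀ {m} → RowVec m → RowVec m → RowVec m → RowVec m
transvection w b u = scale (dot u w) b ⊕ u

transvection-linear : ∀ {m} (w b : RowVec m) → IsLinear (transvection w b)
transvection-linear w b c x y = begin
  scale (dot (scale c x ⊕ y) w) b ⊕ (scale c x ⊕ y)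
    ≡⟨ cong (λ t → scale t b ⊕ (scale c x ⊕ y)) (dot-scale-⊕ c x y w) ⟩
  scale ((c ∧ dot x w) xor dot y w) b ⊕ (scale c x ⊕ y)
    ≡⟨ cong (_⊕ (scale c x ⊕ y)) (scale-distrib-xor (c ∧ dot x w) (dot y w) b) ⟩
  (scale (c ∧ dot x w) b ⊕ scale (dot y w) b) ⊕ (scale c x ⊕ y)
    ≡⟨ cong (λ z → (z ⊕ scale (dot y w) b) ⊕ (scale c x ⊕ y)) (scale-∧ c (dot x w) b) ⟩
  (scale c (scale (dot x w) b) ⊕ scale (dot y w) b) ⊕ (scale c x ⊕ y)
    ≡⟨ ⊕-interchange (scale c (scale (dot x w) b)) (scale (dot y w) b) (scale c x) y ⟩
  (scale c (scale (dot x w) b) ⊕ scale c x) ⊕ transvection w b y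
    ≡⟨ cong (_⊕ transvection w b y) (scale-distrib-⊕ c (scale (dot x w) b) x) ⟨
  scale c (transvection w b x) ⊕ transvection w b y
    ∎
  where open ≡-Reasoning

transvection-⊥ : ∀ {m} (w b u : RowVec m) → dot b w ≡ true → dot (transvection w b u) w ≡ false
transvection-⊥ w b u b·w = begin
  dot (scale (dot u w) b ⊕ u) w       ≡⟨ dot-scale-⊕ (dot u w) b u w ⟩
  (dot u w ∧ dot b w) xor dot u w     ≡⟨ cong (λ t → (dot u w ∧ t) xor dot u w) b·w ⟩
  (dot u w ∧ true) xor dot u w        ≡⟨ cong (_xor dot u w) (BP.∧-identityʳ (dot u w)) ⟩
  dot u w xor dot u w                 ≡⟨ BP.xor-same (dot u w) ⟩
  false                               ∎
  where open ≡-Reasoning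

-- Drop a basis vector b with b·w = 1 and replace every other basis vector u by
-- τ u = u + (u·w) b ∈ w^⊥; a vector c b + u of w^⊥ has c = u·w, so it equals τ u.
module HyperplaneCut {m} {P : RowVec m → Set} (closed : IsLinearlyClosed P) (w : RowVec m)
                     (xs : List (RowVec m)) (b : RowVec m) (ys : List (RowVec m)) (b·w : dot b w ≡ true) where

  open Insertion b ys

  τ : RowVec m → RowVec m
  τ = transvection w b

  rest : List (RowVec m)
  rest = xs ++ ys

  basis : List (RowVec m)
  basis = L.map τ rest

  length-map-τ : length basis ≡ length rest
  length-map-τ = LP.length-map τ rest

  lincomb-basis : ∀ cs → lincomb basis cs ≡ τ (lincomb rest (V.cast length-map-τ cs))
  lincomb-basis = lincomb-map (transvection-linear w b) rest

  length-basis : suc (length basis) ≡ length (xs ++ b ∷ ys)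
  length-basis = begin
    suc (length basis)            ≡⟨ cong suc length-map-τ ⟩
    suc (length (xs ++ ys))       ≡⟨ cong suc (LP.length-++ xs) ⟩
    suc (length xs + length ys)   ≡⟨ +-suc (length xs) (length ys) ⟨
    length xs + length (b ∷ ys)   ≡⟨ LP.length-++ xs ⟨
    length (xs ++ b ∷ ys)         ∎
    where open ≡-Reasoning

  basis-in : All P (xs ++ b ∷ ys) → All (λ u → P u × dot u w ≡ false) basis
  basis-in all∈P with Pb ∷ ys∈P ← AllP.++⁻ʳ xs all∈P =
    AllP.map⁺ (All.map (λ {u} Pu → closed (dot u w) b u Pb Pu , transvection-⊥ w b u b·w)
                       (AllP.++⁺ (AllP.++⁻ˡ xs all∈P) ys∈P))

  independent : LinIndep (xs ++ b ∷ ys) → LinIndep basis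
  independent indep cs cs-kills = cast≡replicate⇒≡replicate length-map-τ cs r≡0
    where
    r : Vec 𝔽₂ (length rest)
    r = V.cast length-map-τ cs
    u : RowVec m
    u = lincomb rest r
    r≡0 : r ≡ V.replicate _ false
    r≡0 = begin
      r                                         ≡⟨ remove-insert xs r (dot u w) ⟨
      remove xs (insert xs r (dot u w))         ≡⟨ cong (remove xs) (indep _ (trans (lincomb-insert xs r (dot u w))
                                                                               (trans (sym (lincomb-basis cs)) cs-kills))) ⟩
      remove xs (V.replicate _ false)           ≡⟨ remove-replicate xs ⟩
      V.replicate _ false                       ∎
      where open ≡-Reasoning

  spans : (∀ v → P v → InSpan (xs ++ b ∷ ys) v) → ∀ v → P v × dot v w ≡ false → InSpan basis v
  spans spansP v (Pv , v·w) with ls , ls-v ← spansP v Pv = V.cast (sym length-map-τ) r , (begin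
    lincomb basis (V.cast (sym length-map-τ) r)   ≡⟨ lincomb-basis _ ⟩
    τ (lincomb rest (V.cast length-map-τ (V.cast (sym length-map-τ) r)))
      ≡⟨ cong (τ ∘ lincomb rest) (VP.cast-sym (sym length-map-τ) refl) ⟩
    scale (dot u w) b ⊕ u                          ≡⟨ cong (λ t → scale t b ⊕ u) u·w ⟩
    scale c b ⊕ u                                  ≡⟨ v-split ⟩
    v                                              ∎)
    where
    open ≡-Reasoning
    c : 𝔽₂
    c = V.lookup ls (position xs)
    r : Vec 𝔽₂ (length rest)
    r = remove xs ls
    u : RowVec m
    u = lincomb rest r
    v-split : scale c b ⊕ u ≡ v
    v-split = trans (sym (lincomb-insert xs r c)) (trans (cong (lincomb (xs ++ b ∷ ys)) (insert-remove xs ls)) ls-v)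
    u·w : dot u w ≡ c
    u·w = xor-false⇒≡ (begin
      c xor dot u w                ≡⟨ cong (_xor dot u w) (trans (cong (c ∧_) b·w) (BP.∧-identityʳ c)) ⟨
      (c ∧ dot b w) xor dot u w    ≡⟨ dot-scale-⊕ c b u w ⟨
      dot (scale c b ⊕ u) w        ≡⟨ cong (λ t → dot t w) v-split ⟩
      dot v w                      ≡⟨ v·w ⟩
      false                        ∎)

hasDim-∩-hyperplane : ∀ {m} {P : RowVec m → Set} {d} → IsLinearlyClosed P → (w : RowVec m) → HasDim P (suc d) →
                      (∃ λ v → P v × dot v w ≡ true) → HasDim (λ v → P v × dot v w ≡ false) d
hasDim-∩-hyperplane closed w (bs , length-bs , all∈P , indep , spansP) (v , Pv , v·w)
  with b , b∈bs , b·w ← generator-not-⊥ (spansP v Pv) v·w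
  with xs , ys , refl ← ∈-∃++ {xs = bs} b∈bs =
  basis , suc-injective (trans length-basis length-bs) , basis-in all∈P , independent indep , spans spansP
  where open HyperplaneCut closed w xs b ys b·w

standardBasis : (m : ℕ) → List (RowVec m)
standardBasis zero = []
standardBasis (suc m) = unit zero ∷ L.map (false ∷_) (standardBasis m)

length-standardBasis : ∀ m → length (standardBasis m) ≡ m
length-standardBasis zero = refl
length-standardBasis (suc m) = cong suc (trans (LP.length-map (false ∷_) (standardBasis m)) (length-standardBasis m))

cons-false-linear : ∀ {m} → IsLinear {m} (false ∷_)
cons-false-linear c x y = cong (_∷ (scale c x ⊕ y)) (cong (_xor false) (sym (BP.∧-zeroʳ c)))

lincomb-standardBasis : ∀ m cs → lincomb (standardBasis m) cs ≡ V.cast (length-standardBasis m) cs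
lincomb-standardBasis zero [] = refl
lincomb-standardBasis (suc m) (c ∷ cs) = begin
  u₀ ⊕ lincomb (L.map (false ∷_) S) cs               ≡⟨ cong (u₀ ⊕_) (lincomb-map cons-false-linear S cs) ⟩
  u₀ ⊕ (false ∷ lincomb S (V.cast e₁ cs))             ≡⟨ cong (λ t → u₀ ⊕ (false ∷ t)) (lincomb-standardBasis m _) ⟩
  u₀ ⊕ (false ∷ V.cast e₂ (V.cast e₁ cs))             ≡⟨ cong (λ t → u₀ ⊕ (false ∷ t)) (Cast.cast-trans e₁ e₂ cs) ⟩
  ((c ∧ true) xor false) ∷ (scale c zeroVec ⊕ cs′)    ≡⟨ cong₂ _∷_ (trans (BP.xor-identityʳ _) (BP.∧-identityʳ c))
                                                                   (trans (cong (_⊕ cs′) (scale-zero c)) (⊕-identityˡ cs′)) ⟩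
  c ∷ cs′                                             ∎
  where
  open ≡-Reasoning
  S : List (RowVec m)
  S = standardBasis m
  e₁ : length (L.map (false ∷_) S) ≡ length S
  e₁ = LP.length-map (false ∷_) S
  e₂ : length S ≡ m
  e₂ = length-standardBasis m
  u₀ : RowVec (suc m)
  u₀ = scale c (unit zero)
  cs′ : Vec 𝔽₂ m
  cs′ = V.cast (trans e₁ e₂) cs

hasDim-full : ∀ m → HasDim {m} (λ _ → ⊤) m
hasDim-full m = standardBasis m , length-standardBasis m , All.universal (λ _ → tt) _ , independent , spans
  where
  independent : LinIndep (standardBasis m)
  independent cs eq = cast≡replicate⇒≡replicate (length-standardBasis m) cs (trans (sym (lincomb-standardBasis m cs)) eq)
  spans : ∀ v → ⊤ → InSpan (standardBasis m) v
  spans v _ = V.cast (sym (length-standardBasis m)) v ,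
              trans (lincomb-standardBasis m _) (VP.cast-sym (sym (length-standardBasis m)) refl)

∈-allVecs : ∀ {n} (x : Vec 𝔽₂ n) → x ∈ allVecs n
∈-allVecs [] = here refl
∈-allVecs {suc n} (false ∷ x) = ∈-++⁺ˡ (∈-map⁺ (false ∷_) (∈-allVecs x))
∈-allVecs {suc n} (true ∷ x) = ∈-++⁺ʳ (L.map (false ∷_) (allVecs n)) (∈-map⁺ (true ∷_) (∈-allVecs x))

T-anyᵇ : ∀ {A : Set} {p : A → Bool} xs → T (anyᵇ p xs) ⇔ Any (T ∘ p) xs
T-anyᵇ [] = mk⇔ (λ ()) (λ ())
T-anyᵇ {p = p} (x ∷ xs) = mk⇔
  (λ h → [ here , there ∘ to (T-anyᵇ xs) ]′ (to (BP.T-∨ {p x}) h))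
  (λ { (here px) → from BP.T-∨ (inj₁ px) ; (there pxs) → from (BP.T-∨ {p x}) (inj₂ (from (T-anyᵇ xs) pxs)) })
  where open Equivalence

T-allᵇ : ∀ {A : Set} {p : A → Bool} xs → T (allᵇ p xs) ⇔ All (T ∘ p) xs
T-allᵇ [] = mk⇔ (λ _ → []) (λ _ → _)
T-allᵇ (x ∷ xs) = mk⇔
  (λ h → let px , pxs = Equivalence.to BP.T-∧ h in px ∷ Equivalence.to (T-allᵇ xs) pxs)
  (λ { (px ∷ pxs) → Equivalence.from BP.T-∧ (px , Equivalence.from (T-allᵇ xs) pxs) })

allᵇ-cong : ∀ {A : Set} {p q : A → Bool} {xs} → All (λ x → p x ≡ q x) xs → allᵇ p xs ≡ allᵇ q xs
allᵇ-cong [] = refl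
allᵇ-cong (px≡qx ∷ eqs) = cong₂ _∧_ px≡qx (allᵇ-cong eqs)

T-eqVecᵇ : ∀ {n} {x y : Vec 𝔽₂ n} → T (eqVecᵇ x y) ⇔ x ≡ y
T-eqVecᵇ {x = []} {[]} = mk⇔ (λ _ → refl) (λ _ → _)
T-eqVecᵇ {x = a ∷ x} {b ∷ y} = mk⇔
  (λ h → let a≡b , x≡y = Equivalence.to BP.T-∧ h
         in cong₂ _∷_ (sym (xor-false⇒≡ (Equivalence.to BP.T-not-≡ a≡b))) (Equivalence.to T-eqVecᵇ x≡y))
  (λ { refl → Equivalence.from BP.T-∧ (Equivalence.from BP.T-not-≡ (BP.xor-same a) , Equivalence.from (T-eqVecᵇ {x = x}) refl) })

T-inSpanᵇ : ∀ {m} (L : List (RowVec m)) v → T (inSpanᵇ L v) ⇔ InSpan L v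
T-inSpanᵇ L v = mk⇔
  (λ h → let cs , _ , eq = find (Equivalence.to (T-anyᵇ (allVecs (length L))) h) in cs , Equivalence.to T-eqVecᵇ eq)
  (λ { (cs , refl) → Equivalence.from (T-anyᵇ (allVecs (length L)))
                        (Any.map (λ { refl → Equivalence.from (T-eqVecᵇ {x = lincomb L cs}) refl }) (∈-allVecs cs)) })

not-from-⇔ : ∀ {b c} → (T b ⇔ (c ≡ false)) → not b ≡ c
not-from-⇔ {true} {false} _ = refl
not-from-⇔ {false} {true} _ = refl
not-from-⇔ {true} {true} b⇔c with () ← Equivalence.to b⇔c tt
not-from-⇔ {false} {false} b⇔c with () ← Equivalence.from b⇔c refl

not-inSpanᵇ : ∀ {m} (L : List (RowVec m)) {w} → SpanIsHyperplane L w → ∀ v → not (inSpanᵇ L v) ≡ dot v w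
not-inSpanᵇ L L≡w⊥ v = not-from-⇔ (L≡w⊥ v ⇔-∘ T-inSpanᵇ L v)

indicator : Bool → ℕ
indicator b = if b then 1 else 0

indicator-T : ∀ {b} → T b → indicator b ≡ 1
indicator-T {true} _ = refl

count≥1 : ∀ {A : Set} (p : A → Bool) {x} xs → x ∈ xs → T (p x) → 1 ≤ countᵇ p xs
count≥1 p (x ∷ xs) (here refl) px = ≤-trans (≤-reflexive (sym (indicator-T px))) (m≤m+n _ (countᵇ p xs))
count≥1 p (y ∷ xs) (there x∈xs) px = ≤-trans (count≥1 p xs x∈xs px) (m≤n+m _ (indicator (p y)))

count≥2 : ∀ {A : Set} (p : A → Bool) {x y} xs → x ≢ y → x ∈ xs → y ∈ xs → T (p x) → T (p y) → 2 ≤ countᵇ p xs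
count≥2 p (z ∷ xs) x≢y (here refl) (here refl) px py = contradiction refl x≢y
count≥2 p (z ∷ xs) x≢y (here refl) (there y∈xs) px py =
  subst (λ k → 2 ≤ k + countᵇ p xs) (sym (indicator-T px)) (s≤s (count≥1 p xs y∈xs py))
count≥2 p (z ∷ xs) x≢y (there x∈xs) (here refl) px py =
  subst (λ k → 2 ≤ k + countᵇ p xs) (sym (indicator-T py)) (s≤s (count≥1 p xs x∈xs px))
count≥2 p (z ∷ xs) x≢y (there x∈xs) (there y∈xs) px py =
  ≤-trans (count≥2 p xs x≢y x∈xs y∈xs px py) (m≤n+m _ (indicator (p z)))

count≥1⇒witness : ∀ {A : Set} (p : A → Bool) xs → 1 ≤ countᵇ p xs → ∃ λ x → x ∈ xs × T (p x)
count≥1⇒witness p (x ∷ xs) h with p x in px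
... | true = x , here refl , Equivalence.from BP.T-≡ px
... | false with y , y∈xs , py ← count≥1⇒witness p xs h = y , there y∈xs , py

count-cong : ∀ {A : Set} {p q : A → Bool} xs → (∀ x → p x ≡ q x) → countᵇ p xs ≡ countᵇ q xs
count-cong [] _ = refl
count-cong (x ∷ xs) p≗q = cong₂ _+_ (cong indicator (p≗q x)) (count-cong xs p≗q)

count-++ : ∀ {A : Set} (p : A → Bool) xs ys → countᵇ p (xs ++ ys) ≡ countᵇ p xs + countᵇ p ys
count-++ p xs ys = trans (cong sum (LP.map-++ (indicator ∘ p) xs ys)) (sum-++ (L.map (indicator ∘ p) xs) (L.map (indicator ∘ p) ys))

count-map : ∀ {A B : Set} (p : B → Bool) (f : A → B) xs → countᵇ p (L.map f xs) ≡ countᵇ (p ∘ f) xs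
count-map p f [] = refl
count-map p f (x ∷ xs) = cong (_ +_) (count-map p f xs)

count-allVecs-suc : ∀ {m} (p : RowVec (suc m) → Bool) →
                    countᵇ p (allVecs (suc m)) ≡ countᵇ (p ∘ (false ∷_)) (allVecs m) + countᵇ (p ∘ (true ∷_)) (allVecs m)
count-allVecs-suc {m} p =
  trans (count-++ p (L.map (false ∷_) (allVecs m)) _) (cong₂ _+_ (count-map p _ (allVecs m)) (count-map p _ (allVecs m)))

count-allVecs : ∀ m → countᵇ (λ (_ : RowVec m) → true) (allVecs m) ≡ 2 ^ m
count-allVecs zero = refl
count-allVecs (suc m) =
  trans (count-allVecs-suc {m} (λ _ → true))
        (trans (cong₂ _+_ (count-allVecs m) (count-allVecs m)) (cong (2 ^ m +_) (sym (+-identityʳ (2 ^ m)))))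

count-translate : ∀ m (p : RowVec m → Bool) u → countᵇ (λ v → p (v ⊕ u)) (allVecs m) ≡ countᵇ p (allVecs m)
count-translate zero p [] = refl
count-translate (suc m) p (false ∷ u) = begin
  countᵇ (λ v → p (v ⊕ (false ∷ u))) (allVecs (suc m))
    ≡⟨ count-allVecs-suc (λ v → p (v ⊕ (false ∷ u))) ⟩
  countᵇ (λ v → p (false ∷ (v ⊕ u))) (allVecs m) + countᵇ (λ v → p (true ∷ (v ⊕ u))) (allVecs m)
    ≡⟨ cong₂ _+_ (count-translate m (p ∘ (false ∷_)) u) (count-translate m (p ∘ (true ∷_)) u) ⟩
  countᵇ (p ∘ (false ∷_)) (allVecs m) + countᵇ (p ∘ (true ∷_)) (allVecs m)
    ≡⟨ count-allVecs-suc p ⟨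
  countᵇ p (allVecs (suc m)) ∎
  where open ≡-Reasoning
count-translate (suc m) p (true ∷ u) = begin
  countᵇ (λ v → p (v ⊕ (true ∷ u))) (allVecs (suc m))
    ≡⟨ count-allVecs-suc (λ v → p (v ⊕ (true ∷ u))) ⟩
  countᵇ (λ v → p (true ∷ (v ⊕ u))) (allVecs m) + countᵇ (λ v → p (false ∷ (v ⊕ u))) (allVecs m)
    ≡⟨ cong₂ _+_ (count-translate m (p ∘ (true ∷_)) u) (count-translate m (p ∘ (false ∷_)) u) ⟩
  countᵇ (p ∘ (true ∷_)) (allVecs m) + countᵇ (p ∘ (false ∷_)) (allVecs m)
    ≡⟨ +-comm (countᵇ (p ∘ (true ∷_)) (allVecs m)) _ ⟩
  countᵇ (p ∘ (false ∷_)) (allVecs m) + countᵇ (p ∘ (true ∷_)) (allVecs m)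
    ≡⟨ count-allVecs-suc p ⟨
  countᵇ p (allVecs (suc m)) ∎
  where open ≡-Reasoning

count-split : ∀ {A : Set} (p q : A → Bool) xs →
              countᵇ (λ x → p x ∧ q x) xs + countᵇ (λ x → not (p x) ∧ q x) xs ≡ countᵇ q xs
count-split p q [] = refl
count-split p q (x ∷ xs) =
  trans (+-interchange (indicator (p x ∧ q x)) _ (indicator (not (p x) ∧ q x)) _)
        (cong₂ _+_ (split-indicator (p x) (q x)) (count-split p q xs))
  where
  split-indicator : ∀ a b → indicator (a ∧ b) + indicator (not a ∧ b) ≡ indicator b
  split-indicator false b = refl
  split-indicator true false = refl
  split-indicator true true = refl

count-halves : ∀ {m} (f g : RowVec m → Bool) a → (∀ v → f (v ⊕ a) ≡ not (f v)) → (∀ v → g (v ⊕ a) ≡ g v) →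
               countᵇ (λ v → f v ∧ g v) (allVecs m) * 2 ≡ countᵇ g (allVecs m)
count-halves {m} f g a flips fixes = begin
  N * 2                                                         ≡⟨ *-comm N 2 ⟩
  N + (N + 0)                                                   ≡⟨ cong (N +_) (+-identityʳ N) ⟩
  N + N                                                         ≡⟨ cong (N +_) translated ⟨
  N + countᵇ (λ v → not (f v) ∧ g v) (allVecs m)                ≡⟨ count-split f g (allVecs m) ⟩
  countᵇ g (allVecs m)                                          ∎
  where
  open ≡-Reasoning
  N : ℕ
  N = countᵇ (λ v → f v ∧ g v) (allVecs m)
  translated : countᵇ (λ v → not (f v) ∧ g v) (allVecs m) ≡ N
  translated = trans (count-cong (allVecs m) λ v → sym (cong₂ _∧_ (flips v) (fixes v)))
                     (count-translate m (λ v → f v ∧ g v) a)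

-- Binary expansions and dyadic intervals

binaryValue : List 𝔽₂ → ℕ
binaryValue [] = 0
binaryValue (b ∷ bs) = (if b then 2 ^ length bs else 0) + binaryValue bs

scaledφ≡binaryValue : ∀ {n} (y : Vec 𝔽₂ n) → scaledφ y ≡ binaryValue (V.toList y)
scaledφ≡binaryValue [] = refl
scaledφ≡binaryValue (b ∷ ys) rewrite VP.length-toList ys = cong (_ +_) (scaledφ≡binaryValue ys)

binaryValue< : ∀ bs → binaryValue bs < 2 ^ length bs
binaryValue< [] = s≤s z≤n
binaryValue< (false ∷ bs) = ≤-trans (binaryValue< bs) (m≤m+n (2 ^ length bs) _)
binaryValue< (true ∷ bs) = +-monoʳ-< (2 ^ length bs) (≤-trans (binaryValue< bs) (m≤m+n (2 ^ length bs) 0))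

binaryValue-++ : ∀ xs ys → binaryValue (xs ++ ys) ≡ binaryValue xs * 2 ^ length ys + binaryValue ys
binaryValue-++ [] ys = refl
binaryValue-++ (false ∷ xs) ys = binaryValue-++ xs ys
binaryValue-++ (true ∷ xs) ys = begin
  2 ^ length (xs ++ ys) + binaryValue (xs ++ ys)
    ≡⟨ cong₂ _+_ (trans (cong (2 ^_) (LP.length-++ xs)) (^-distribˡ-+-* 2 (length xs) (length ys))) (binaryValue-++ xs ys) ⟩
  2 ^ length xs * Q + (binaryValue xs * Q + binaryValue ys)
    ≡⟨ +-assoc (2 ^ length xs * Q) (binaryValue xs * Q) (binaryValue ys) ⟨
  2 ^ length xs * Q + binaryValue xs * Q + binaryValue ys
    ≡⟨ cong (_+ binaryValue ys) (*-distribʳ-+ Q (2 ^ length xs) (binaryValue xs)) ⟨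
  (2 ^ length xs + binaryValue xs) * Q + binaryValue ys ∎
  where
  open ≡-Reasoning
  Q : ℕ
  Q = 2 ^ length ys

leading-one-dominates : ∀ xs ys → length xs ≡ length ys → 2 ^ length xs + binaryValue xs ≢ binaryValue ys
leading-one-dominates xs ys len eq = <-irrefl (sym eq) (begin-strict
  binaryValue ys                 <⟨ binaryValue< ys ⟩
  2 ^ length ys                  ≡⟨ cong (2 ^_) len ⟨
  2 ^ length xs                  ≤⟨ m≤m+n (2 ^ length xs) (binaryValue xs) ⟩
  2 ^ length xs + binaryValue xs ∎)
  where open ≤-Reasoning

binaryValue-injective : ∀ xs ys → length xs ≡ length ys → binaryValue xs ≡ binaryValue ys → xs ≡ ys
binaryValue-injective [] [] _ _ = refl
binaryValue-injective (false ∷ xs) (false ∷ ys) len eq =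
  cong (false ∷_) (binaryValue-injective xs ys (suc-injective len) eq)
binaryValue-injective (true ∷ xs) (true ∷ ys) len eq =
  cong (true ∷_) (binaryValue-injective xs ys len′ (+-cancelˡ-≡ (2 ^ length xs) _ _
    (trans eq (cong (λ n → 2 ^ n + binaryValue ys) (sym len′)))))
  where
  len′ : length xs ≡ length ys
  len′ = suc-injective len
binaryValue-injective (true ∷ xs) (false ∷ ys) len eq = contradiction eq (leading-one-dominates xs ys (suc-injective len))
binaryValue-injective (false ∷ xs) (true ∷ ys) len eq = contradiction (sym eq) (leading-one-dominates ys xs (suc-injective (sym len)))

interval-contains : ∀ t {Q r} → r < Q → t * Q ≤ t * Q + r × t * Q + r < suc t * Q
interval-contains t {Q} {r} r<Q = m≤m+n (t * Q) r , (begin-strict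
  t * Q + r   <⟨ +-monoʳ-< (t * Q) r<Q ⟩
  t * Q + Q   ≡⟨ +-comm (t * Q) Q ⟩
  suc t * Q   ∎)
  where open ≤-Reasoning

interval-unique : ∀ t a {Q r} → r < Q → a * Q ≤ t * Q + r → t * Q + r < suc a * Q → t ≡ a
interval-unique t a {Q} {r} r<Q aQ≤N N<[1+a]Q = ≤-antisym (m<1+n⇒m≤n t<1+a) (m<1+n⇒m≤n a<1+t)
  where
  t<1+a : t < suc a
  t<1+a = *-cancelʳ-< Q t (suc a) (≤-<-trans (proj₁ (interval-contains t r<Q)) N<[1+a]Q)
  a<1+t : a < suc t
  a<1+t = *-cancelʳ-< Q a (suc t) (≤-<-trans aQ≤N (proj₂ (interval-contains t r<Q)))

T-inDyadic : ∀ {m d a N} → T (inDyadicᵇ m d a N) ⇔ (a * 2 ^ (m ∸ d) ≤ N × N < suc a * 2 ^ (m ∸ d))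
T-inDyadic {m} {d} {a} {N} = mk⇔
  (λ h → let l , r = Equivalence.to BP.T-∧ h in ≤ᵇ⇒≤ _ N l , <ᵇ⇒< N _ r)
  (λ (l , r) → Equivalence.from BP.T-∧ (≤⇒≤ᵇ l , <⇒<ᵇ r))

leadingDigits : ∀ {m} → ℕ → Vec 𝔽₂ m → List 𝔽₂
leadingDigits d y = take d (V.toList y)

module DyadicDigits {m} (d : ℕ) (y : Vec 𝔽₂ m) where

  trailing : List 𝔽₂
  trailing = drop d (V.toList y)

  length-trailing : length trailing ≡ m ∸ d
  length-trailing = trans (LP.length-drop d (V.toList y)) (cong (_∸ d) (VP.length-toList y))

  trailing< : binaryValue trailing < 2 ^ (m ∸ d)
  trailing< = subst (λ k → binaryValue trailing < 2 ^ k) length-trailing (binaryValue< trailing)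

  scaledφ-split : scaledφ y ≡ binaryValue (leadingDigits d y) * 2 ^ (m ∸ d) + binaryValue trailing
  scaledφ-split = begin
    scaledφ y ≡⟨ scaledφ≡binaryValue y ⟩
    binaryValue (V.toList y) ≡⟨ cong binaryValue (LP.take++drop≡id d (V.toList y)) ⟨
    binaryValue (leadingDigits d y ++ trailing) ≡⟨ binaryValue-++ (leadingDigits d y) trailing ⟩
    binaryValue (leadingDigits d y) * 2 ^ length trailing + binaryValue trailing
      ≡⟨ cong (λ k → binaryValue (leadingDigits d y) * 2 ^ k + binaryValue trailing) length-trailing ⟩
    binaryValue (leadingDigits d y) * 2 ^ (m ∸ d) + binaryValue trailing ∎
    where open ≡-Reasoning

  inDyadic-leadingDigits : T (inDyadicᵇ m d (binaryValue (leadingDigits d y)) (scaledφ y))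
  inDyadic-leadingDigits rewrite scaledφ-split =
    Equivalence.from (T-inDyadic {m} {d} {binaryValue (leadingDigits d y)}) (interval-contains (binaryValue (leadingDigits d y)) trailing<)

  inDyadic⇒leadingDigits : ∀ a → T (inDyadicᵇ m d a (scaledφ y)) → binaryValue (leadingDigits d y) ≡ a
  inDyadic⇒leadingDigits a h rewrite scaledφ-split =
    let lower , upper = Equivalence.to (T-inDyadic {m} {d} {a}) h in interval-unique _ a trailing< lower upper

fromBits : ∀ {m} → Vec 𝔽₂ m → ℕ
fromBits [] = 0
fromBits (b ∷ bs) = indicator b + fromBits bs * 2

bits-fromBits : ∀ {m} (ι : Vec 𝔽₂ m) → bits m (fromBits ι) ≡ ι
bits-fromBits [] = refl
bits-fromBits (false ∷ bs) =
  cong₂ _∷_ (cong (_≡ᵇ 1) ([m+kn]%n≡m%n 0 (fromBits bs) 2))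
            (trans (cong (bits _) (m*n/n≡m (fromBits bs) 2)) (bits-fromBits bs))
bits-fromBits (true ∷ bs) =
  cong₂ _∷_ (cong (_≡ᵇ 1) ([m+kn]%n≡m%n 1 (fromBits bs) 2))
            (trans (cong (bits _) (trans (+-distrib-/-∣ʳ 1 {d = 2} (divides (fromBits bs) refl)) (m*n/n≡m (fromBits bs) 2)))
                   (bits-fromBits bs))

fromBits< : ∀ {m} (ι : Vec 𝔽₂ m) → fromBits ι < 2 ^ m
fromBits< [] = s≤s z≤n
fromBits< {suc m} (b ∷ bs) = begin-strict
  indicator b + fromBits bs * 2          <⟨ s≤s (+-monoˡ-≤ (fromBits bs * 2) (bit≤1 b)) ⟩
  suc (fromBits bs) * 2                  ≤⟨ *-monoˡ-≤ 2 (fromBits< bs) ⟩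
  2 ^ m * 2                              ≡⟨ *-comm (2 ^ m) 2 ⟩
  2 ^ suc m                              ∎
  where
  open ≤-Reasoning
  bit≤1 : ∀ b → indicator b ≤ 1
  bit≤1 false = z≤n
  bit≤1 true = s≤s z≤n

-- Digital (0,m,3)-nets

++-cancel-length : ∀ {A : Set} (xs xs′ : List A) {ys ys′} → length xs ≡ length xs′ →
                   xs ++ ys ≡ xs′ ++ ys′ → xs ≡ xs′ × ys ≡ ys′
++-cancel-length [] [] _ eq = refl , eq
++-cancel-length (x ∷ xs) (x′ ∷ xs′) len eq =
  let xs≡ , ys≡ = ++-cancel-length xs xs′ (suc-injective len) (LP.∷-injectiveʳ eq)
  in cong₂ _∷_ (LP.∷-injectiveˡ eq) xs≡ , ys≡

length-take-≤ : ∀ {A : Set} d (xs : List A) → d ≤ length xs → length (take d xs) ≡ d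
length-take-≤ d xs d≤ = trans (LP.length-take d xs) (m≤n⇒m⊓n≡m d≤)

evaluation-firstRows : ∀ {m} (X : Mat m) d ι → L.map (λ r → dot r ι) (firstRows X d) ≡ leadingDigits d (matVec X ι)
evaluation-firstRows X d ι = trans (sym (LP.take-map d (V.toList X))) (cong (take d) (sym (VP.toList-map _ X)))

module ZeroNet {m} (A B C : Mat m) (net : IsNet (A ∷ B ∷ C ∷ []) 0)
               (d₁ d₂ d₃ : ℕ) (d-sum : d₁ + (d₂ + d₃) ≡ m) where

  Cs : Vec (Mat m) 3
  Cs = A ∷ B ∷ C ∷ []

  ds : Fin 3 → ℕ
  ds = V.lookup (d₁ ∷ d₂ ∷ d₃ ∷ [])

  ds≤m : ∀ i → ds i ≤ m
  ds≤m zero = subst (d₁ ≤_) d-sum (m≤m+n d₁ _)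
  ds≤m (suc zero) = subst (d₂ ≤_) d-sum (≤-trans (m≤m+n d₂ d₃) (m≤n+m _ d₁))
  ds≤m (suc (suc zero)) = subst (d₃ ≤_) d-sum (≤-trans (m≤n+m d₃ d₂) (m≤n+m _ d₁))

  digits : RowVec m → Fin 3 → List 𝔽₂
  digits ι i = leadingDigits (ds i) (matVec (V.lookup Cs i) ι)

  length-digits : ∀ ι i → length (digits ι i) ≡ ds i
  length-digits ι i = length-take-≤ (ds i) _ (subst (ds i ≤_) (sym (VP.length-toList (matVec (V.lookup Cs i) ι))) (ds≤m i))

  boxOf : RowVec m → Fin 3 → ℕ
  boxOf ι i = binaryValue (digits ι i)

  boxOf< : ∀ ι i → boxOf ι i < 2 ^ ds i
  boxOf< ι i = subst (λ k → boxOf ι i < 2 ^ k) (length-digits ι i) (binaryValue< (digits ι i))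

  InBox : (Fin 3 → ℕ) → ℕ → Bool
  InBox as l = allᵇ (λ i → inDyadicᵇ m (ds i) (as i) (scaledPoint Cs l i)) (L.allFin 3)

  T-InBox : ∀ as l → T (InBox as l) ⇔ (∀ i → boxOf (bits m l) i ≡ as i)
  T-InBox as l = mk⇔
    (λ h i → DyadicDigits.inDyadic⇒leadingDigits (ds i) (point i) (as i)
               (AllP.tabulate⁻ {f = id} (to (T-allᵇ {p = inDyadicAt} (L.allFin 3)) h) i))
    (λ h → from (T-allᵇ {p = inDyadicAt} (L.allFin 3)) (AllP.tabulate⁺ {f = id} λ i →
       subst (λ a → T (inDyadicᵇ m (ds i) a _)) (h i) (DyadicDigits.inDyadic-leadingDigits (ds i) (point i))))
    where
    open Equivalence
    inDyadicAt : Fin 3 → Bool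
    inDyadicAt i = inDyadicᵇ m (ds i) (as i) (scaledPoint Cs l i)
    point : Fin 3 → RowVec m
    point i = matVec (V.lookup Cs i) (bits m l)

  one-point : ∀ as → (∀ i → as i < 2 ^ ds i) → pointsInBox Cs ds as ≡ 1
  one-point = proj₂ net ds (trans (cong (λ k → d₁ + (d₂ + k)) (+-identityʳ d₃)) d-sum)

  boxOf-surjective : ∀ as → (∀ i → as i < 2 ^ ds i) → ∃ λ ι → ∀ i → boxOf ι i ≡ as i
  boxOf-surjective as as< with l , _ , l∈box ← count≥1⇒witness (InBox as) (upTo (2 ^ m)) (≤-reflexive (sym (one-point as as<))) =
    bits m l , Equivalence.to (T-InBox as l) l∈box

  boxOf-injective : ∀ ι ι′ → (∀ i → boxOf ι i ≡ boxOf ι′ i) → ι ≡ ι′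
  boxOf-injective ι ι′ same with fromBits ι ≟ fromBits ι′
  ... | yes eq = trans (sym (bits-fromBits ι)) (trans (cong (bits m) eq) (bits-fromBits ι′))
  ... | no ne = contradiction (count≥2 (InBox (boxOf ι)) (upTo (2 ^ m)) ne (∈-upTo⁺ (fromBits< ι)) (∈-upTo⁺ (fromBits< ι′))
                                        (in-own-box ι (λ _ → refl)) (in-own-box ι′ (sym ∘ same)))
                               (<-irrefl (sym (one-point (boxOf ι) (boxOf< ι))))
    where
    in-own-box : ∀ κ → (∀ i → boxOf κ i ≡ boxOf ι i) → T (InBox (boxOf ι) (fromBits κ))
    in-own-box κ h = Equivalence.from (T-InBox (boxOf ι) (fromBits κ)) λ i → trans (cong (λ z → boxOf z i) (bits-fromBits κ)) (h i)

  rows : List (RowVec m)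
  rows = firstRows A d₁ ++ firstRows B d₂ ++ firstRows C d₃

  concat₃ : (Fin 3 → List 𝔽₂) → List 𝔽₂
  concat₃ t = t zero ++ t (suc zero) ++ t (suc (suc zero))

  concat₃-cong : ∀ {t t′} → (∀ i → t i ≡ t′ i) → concat₃ t ≡ concat₃ t′
  concat₃-cong t≡t′ = cong₂ _++_ (t≡t′ zero) (cong₂ _++_ (t≡t′ (suc zero)) (t≡t′ (suc (suc zero))))

  toList-evaluation : ∀ ι → V.toList (evaluation (V.fromList rows) ι) ≡ concat₃ (digits ι)
  toList-evaluation ι = begin
    V.toList (evaluation (V.fromList rows) ι) ≡⟨ VP.toList-map _ (V.fromList rows) ⟩
    L.map dot-ι (V.toList (V.fromList rows)) ≡⟨ cong (L.map dot-ι) (VP.toList∘fromList rows) ⟩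
    L.map dot-ι rows                          ≡⟨ LP.map-++ dot-ι (firstRows A d₁) _ ⟩
    L.map dot-ι (firstRows A d₁) ++ L.map dot-ι (firstRows B d₂ ++ firstRows C d₃)
      ≡⟨ cong (L.map dot-ι (firstRows A d₁) ++_) (LP.map-++ dot-ι (firstRows B d₂) _) ⟩
    L.map dot-ι (firstRows A d₁) ++ L.map dot-ι (firstRows B d₂) ++ L.map dot-ι (firstRows C d₃)
      ≡⟨ cong₂ _++_ (evaluation-firstRows A d₁ ι) (cong₂ _++_ (evaluation-firstRows B d₂ ι) (evaluation-firstRows C d₃ ι)) ⟩
    concat₃ (digits ι) ∎
    where
    open ≡-Reasoning
    dot-ι : RowVec m → 𝔽₂
    dot-ι r = dot r ι

  length-rows : length rows ≡ d₁ + (d₂ + d₃)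
  length-rows = trans (LP.length-++ (firstRows A d₁)) (cong₂ _+_ (length-firstRows A zero)
    (trans (LP.length-++ (firstRows B d₂)) (cong₂ _+_ (length-firstRows B (suc zero)) (length-firstRows C (suc (suc zero))))))
    where
    length-firstRows : ∀ X i → length (firstRows X (ds i)) ≡ ds i
    length-firstRows X i = length-take-≤ (ds i) (V.toList X) (subst (ds i ≤_) (sym (VP.length-toList X)) (ds≤m i))

  evaluation-injective : ∀ ι ι′ → evaluation (V.fromList rows) ι ≡ evaluation (V.fromList rows) ι′ → ι ≡ ι′
  evaluation-injective ι ι′ eq = boxOf-injective ι ι′ (cong binaryValue ∘ same-digits)
    where
    same-length : ∀ i → length (digits ι i) ≡ length (digits ι′ i)
    same-length i = trans (length-digits ι i) (sym (length-digits ι′ i))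
    same-digits : ∀ i → digits ι i ≡ digits ι′ i
    same-digits
      with e₁ , e₂₃ ← ++-cancel-length (digits ι zero) (digits ι′ zero) (same-length zero)
                        (trans (sym (toList-evaluation ι)) (trans (cong V.toList eq) (toList-evaluation ι′)))
      with e₂ , e₃ ← ++-cancel-length (digits ι (suc zero)) (digits ι′ (suc zero)) (same-length (suc zero)) e₂₃ = λ where
        zero → e₁
        (suc zero) → e₂
        (suc (suc zero)) → e₃

  module Split (zs : List 𝔽₂) (len : length zs ≡ d₁ + (d₂ + d₃)) where

    parts : Fin 3 → List 𝔽₂
    parts zero = take d₁ zs
    parts (suc zero) = take d₂ (drop d₁ zs)
    parts (suc (suc zero)) = drop d₂ (drop d₁ zs)

    parts-++ : concat₃ parts ≡ zs
    parts-++ = trans (cong (take d₁ zs ++_) (LP.take++drop≡id d₂ (drop d₁ zs))) (LP.take++drop≡id d₁ zs)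

    length-rest : length (drop d₁ zs) ≡ d₂ + d₃
    length-rest = trans (LP.length-drop d₁ zs) (trans (cong (_∸ d₁) len) (m+n∸m≡n d₁ (d₂ + d₃)))

    length-parts : ∀ i → length (parts i) ≡ ds i
    length-parts zero = length-take-≤ d₁ zs (subst (d₁ ≤_) (sym len) (m≤m+n d₁ _))
    length-parts (suc zero) = length-take-≤ d₂ (drop d₁ zs) (subst (d₂ ≤_) (sym length-rest) (m≤m+n d₂ d₃))
    length-parts (suc (suc zero)) = trans (LP.length-drop d₂ (drop d₁ zs)) (trans (cong (_∸ d₂) length-rest) (m+n∸m≡n d₂ d₃))

  evaluation-surjective : ∀ y → ∃ λ ι → evaluation (V.fromList rows) ι ≡ y
  evaluation-surjective y = ι , toList-injective (begin
    V.toList (evaluation (V.fromList rows) ι) ≡⟨ toList-evaluation ι ⟩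
    concat₃ (digits ι)                        ≡⟨ concat₃-cong digits≡parts ⟩
    concat₃ parts                             ≡⟨ parts-++ ⟩
    V.toList y                                ∎)
    where
    open ≡-Reasoning
    open Split (V.toList y) (trans (VP.length-toList y) length-rows)
    ι-box : ∃ λ ι → ∀ i → boxOf ι i ≡ binaryValue (parts i)
    ι-box = boxOf-surjective (binaryValue ∘ parts) λ i →
              subst (λ k → binaryValue (parts i) < 2 ^ k) (length-parts i) (binaryValue< (parts i))
    ι : RowVec m
    ι = proj₁ ι-box
    digits≡parts : ∀ i → digits ι i ≡ parts i
    digits≡parts i = binaryValue-injective _ _ (trans (length-digits ι i) (sym (length-parts i))) (proj₂ ι-box i)
    toList-injective : ∀ {n} {u v : Vec 𝔽₂ n} → V.toList u ≡ V.toList v → u ≡ v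
    toList-injective {u = u} {v} eq = trans (sym (Cast.cast-is-id refl u)) (VP.toList-injective refl u v eq)

  evaluation-bijective : Bijective _≡_ _≡_ (evaluation (V.fromList rows))
  evaluation-bijective = evaluation-injective _ _ , λ y → let ι , eq = evaluation-surjective y in ι , λ { refl → eq }

-- The subspaces V_{i,j}

lookupOr : ∀ {A : Set} → A → List A → ℕ → A
lookupOr d [] i = d
lookupOr d (x ∷ xs) zero = x
lookupOr d (x ∷ xs) (suc i) = lookupOr d xs i

take-suc-lookupOr : ∀ {A : Set} (d : A) xs i → i < length xs → take (suc i) xs ≡ take i xs ++ lookupOr d xs i ∷ []
take-suc-lookupOr d (x ∷ xs) zero _ = refl
take-suc-lookupOr d (x ∷ xs) (suc i) (s≤s i<) = cong (x ∷_) (take-suc-lookupOr d xs i i<)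

lookupOr∈take : ∀ {A : Set} (d : A) xs {p q} → p < q → p < length xs → lookupOr d xs p ∈ take q xs
lookupOr∈take d (x ∷ xs) {zero} {suc q} _ _ = here refl
lookupOr∈take d (x ∷ xs) {suc p} {suc q} (s≤s p<q) (s≤s p<) = there (lookupOr∈take d xs p<q p<)

split-dimension : ∀ {m} i j → suc i + j ≤ m → suc i + (m ∸ i ∸ j ∸ 1 + j) ≡ m
split-dimension {m} i j le = begin
  suc i + (m ∸ i ∸ j ∸ 1 + j)     ≡⟨ cong (λ x → suc i + (x + j)) remaining ⟩
  suc i + (m ∸ (suc i + j) + j)   ≡⟨ +-left-comm (suc i) (m ∸ (suc i + j)) j ⟩
  m ∸ (suc i + j) + (suc i + j)   ≡⟨ m∸n+n≡m le ⟩
  m                               ∎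
  where
  open ≡-Reasoning
  remaining : m ∸ i ∸ j ∸ 1 ≡ m ∸ (suc i + j)
  remaining = begin
    m ∸ i ∸ j ∸ 1     ≡⟨ ∸-+-assoc (m ∸ i) j 1 ⟩
    m ∸ i ∸ (j + 1)   ≡⟨ cong (m ∸ i ∸_) (+-comm j 1) ⟩
    m ∸ i ∸ suc j     ≡⟨ ∸-+-assoc m i (suc j) ⟩
    m ∸ (i + suc j)   ≡⟨ cong (m ∸_) (+-suc i j) ⟩
    m ∸ (suc i + j)   ∎

module HyperplaneFamily {m} (A B C : Mat m) (net : IsNet (A ∷ B ∷ C ∷ []) 0) (j : ℕ) (j<m : j < m) where

  n : ℕ
  n = m ∸ j

  Vj : ℕ → List (RowVec m)
  Vj i = Vgens A B C i j

  -- a i is the paper's a_{i+1}; the default zeroVec is only reached for i ≥ m.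
  a : ℕ → RowVec m
  a = lookupOr zeroVec (V.toList A)

  <n⇒<rows : ∀ {i} → i < n → i < length (V.toList A)
  <n⇒<rows i<n = subst (_ <_) (sym (VP.length-toList A)) (≤-trans i<n (m∸n≤m m j))

  hyperplane : ∀ {i} → i < n → ∃ λ w → SpanIsHyperplane (Vj i) w × dot (a i) w ≡ true
  hyperplane {i} i<n = basis-without-one-spans-hyperplane (firstRows A i) (a i) Y
      (subst (λ L → Bijective _≡_ _≡_ (evaluation (V.fromList L))) rows≡
             (ZeroNet.evaluation-bijective A B C net (suc i) (m ∸ i ∸ j ∸ 1) j dims))
    where
    Y : List (RowVec m)
    Y = firstRows B (m ∸ i ∸ j ∸ 1) ++ firstRows C j
    rows≡ : firstRows A (suc i) ++ Y ≡ firstRows A i ++ a i ∷ Y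
    rows≡ = trans (cong (_++ Y) (take-suc-lookupOr zeroVec (V.toList A) i (<n⇒<rows i<n)))
                  (LP.++-assoc (firstRows A i) (a i ∷ []) Y)
    dims : suc i + (m ∸ i ∸ j ∸ 1 + j) ≡ m
    dims = split-dimension i j (subst (suc i + j ≤_) (m∸n+n≡m (<⇒≤ j<m)) (+-monoˡ-≤ j i<n))

  normal : ∀ {i} → i < n → RowVec m
  normal = proj₁ ∘ hyperplane

  Vj≡normal⊥ : ∀ {i} (i<n : i < n) → SpanIsHyperplane (Vj i) (normal i<n)
  Vj≡normal⊥ = proj₁ ∘ proj₂ ∘ hyperplane

  a·normal : ∀ {i} (i<n : i < n) → dot (a i) (normal i<n) ≡ true
  a·normal = proj₂ ∘ proj₂ ∘ hyperplane

  a∈Vj : ∀ {p q} → p < q → q < n → InSpan (Vj q) (a p)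
  a∈Vj p<q q<n = ∈⇒InSpan (∈-++⁺ˡ (lookupOr∈take zeroVec (V.toList A) p<q (<-trans p<q (<n⇒<rows q<n))))

  InAll : ∀ {k} → (Fin k → ℕ) → RowVec m → Set
  InAll is v = ∀ l → InSpan (Vj (is l)) v

  hasDim-InAll : ∀ k (is : Fin k → ℕ) → (∀ p q → p F.< q → is p < is q) → (∀ l → is l < n) → k ≤ m →
                 HasDim (InAll is) (m ∸ k)
  hasDim-InAll zero is _ _ _ = HasDim-resp (λ _ → mk⇔ (λ _ ()) (λ _ → tt)) (hasDim-full m)
  hasDim-InAll (suc k) is increasing bounded 1+k≤m =
    HasDim-resp (λ v → mk⇔ split⁻¹ split)
      (hasDim-∩-hyperplane closed w (subst (HasDim (InAll (is ∘ suc))) (+-∸-assoc 1 1+k≤m) IH) witness)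
    where
    open Equivalence
    w : RowVec m
    w = normal (bounded zero)
    IH : HasDim (InAll (is ∘ suc)) (m ∸ k)
    IH = hasDim-InAll k (is ∘ suc) (λ p q p<q → increasing (suc p) (suc q) (s≤s p<q)) (bounded ∘ suc) (<⇒≤ 1+k≤m)
    closed : IsLinearlyClosed (InAll (is ∘ suc))
    closed c x y x∈ y∈ l = hyperplane-closed (Vj (is (suc l))) (Vj≡normal⊥ (bounded (suc l))) c x y (x∈ l) (y∈ l)
    witness : ∃ λ v → InAll (is ∘ suc) v × dot v w ≡ true
    witness = a (is zero) , (λ l → a∈Vj (increasing zero (suc l) (s≤s z≤n)) (bounded (suc l))) , a·normal (bounded zero)
    split⁻¹ : ∀ {v} → InAll (is ∘ suc) v × dot v w ≡ false → InAll is v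
    split⁻¹ (v∈rest , v·w) zero = from (Vj≡normal⊥ (bounded zero) _) v·w
    split⁻¹ (v∈rest , v·w) (suc l) = v∈rest l
    split : ∀ {v} → InAll is v → InAll (is ∘ suc) v × dot v w ≡ false
    split v∈all = v∈all ∘ suc , to (Vj≡normal⊥ (bounded zero) _) (v∈all zero)

  outside : ℕ → RowVec m → Bool
  outside i v = not (inSpanᵇ (Vj i) v)

  outside-⊕ : ∀ {i} → i < n → ∀ v x → outside i (v ⊕ x) ≡ outside i v xor outside i x
  outside-⊕ {i} i<n v x = begin
    outside i (v ⊕ x)      ≡⟨ outside≡dot (v ⊕ x) ⟩
    dot (v ⊕ x) w          ≡⟨ dot-distribʳ-⊕ v x w ⟩
    dot v w xor dot x w    ≡⟨ cong₂ _xor_ (outside≡dot v) (outside≡dot x) ⟨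
    outside i v xor outside i x ∎
    where
    open ≡-Reasoning
    w : RowVec m
    w = normal i<n
    outside≡dot : ∀ u → outside i u ≡ dot u w
    outside≡dot = not-inSpanᵇ (Vj i) (Vj≡normal⊥ i<n)

  outside-a : ∀ {i} → i < n → outside i (a i) ≡ true
  outside-a {i} i<n = trans (not-inSpanᵇ (Vj i) (Vj≡normal⊥ i<n) (a i)) (a·normal i<n)

  outside-earlier-a : ∀ {p q} → p < q → q < n → outside q (a p) ≡ false
  outside-earlier-a {p} {q} p<q q<n =
    trans (not-inSpanᵇ (Vj q) (Vj≡normal⊥ q<n) (a p)) (Equivalence.to (Vj≡normal⊥ q<n (a p)) (a∈Vj p<q q<n))

  count-outside : ∀ is → AllPairs _<_ is → All (_< n) is →
                  countᵇ (λ v → allᵇ (λ i → outside i v) is) (allVecs m) * 2 ^ length is ≡ 2 ^ m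
  count-outside [] [] [] = trans (*-identityʳ _) (count-allVecs m)
  count-outside (i ∷ is) (i<is ∷ sorted) (i<n ∷ bounded) = begin
    N * (2 * 2 ^ length is)                 ≡⟨ *-assoc N 2 _ ⟨
    N * 2 * 2 ^ length is                   ≡⟨ cong (_* 2 ^ length is) (count-halves (outside i) rest (a i) flips fixes) ⟩
    countᵇ rest (allVecs m) * 2 ^ length is ≡⟨ count-outside is sorted bounded ⟩
    2 ^ m                                   ∎
    where
    open ≡-Reasoning
    rest : RowVec m → Bool
    rest v = allᵇ (λ q → outside q v) is
    N : ℕ
    N = countᵇ (λ v → outside i v ∧ rest v) (allVecs m)
    flips : ∀ v → outside i (v ⊕ a i) ≡ not (outside i v)
    flips v = trans (outside-⊕ i<n v (a i)) (trans (cong (outside i v xor_) (outside-a i<n))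
                    (trans (BP.xor-comm _ true) (BP.true-xor _)))
    fixes : ∀ v → rest (v ⊕ a i) ≡ rest v
    fixes v = allᵇ-cong (All.zipWith (λ (i<q , q<n) → fixed i<q q<n) (i<is , bounded))
      where
      fixed : ∀ {q} → i < q → q < n → outside q (v ⊕ a i) ≡ outside q v
      fixed {q} i<q q<n = trans (outside-⊕ q<n v (a i))
        (trans (cong (outside q v xor_) (outside-earlier-a i<q q<n)) (BP.xor-identityʳ (outside q v)))

  count-outside-all : countᵇ (λ v → allᵇ (λ i → outside i v) (upTo n)) (allVecs m) ≡ 2 ^ j
  count-outside-all = *-cancelʳ-≡ _ _ (2 ^ n) {{m^n≢0 2 n}} (begin
    N * 2 ^ n                 ≡⟨ cong (λ k → N * 2 ^ k) (LP.length-upTo n) ⟨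
    N * 2 ^ length (upTo n)   ≡⟨ count-outside (upTo n) (AllPairsP.applyUpTo⁺₁ id n (λ i<k _ → i<k)) (AllP.all-upTo n) ⟩
    2 ^ m                     ≡⟨ cong (2 ^_) (m+[n∸m]≡n (<⇒≤ j<m)) ⟨
    2 ^ (j + n)               ≡⟨ ^-distribˡ-+-* 2 j n ⟩
    2 ^ j * 2 ^ n             ∎)
    where
    open ≡-Reasoning
    N : ℕ
    N = countᵇ (λ v → allᵇ (λ i → outside i v) (upTo n)) (allVecs m)

lemma10 : (m : ℕ) (A B C : Mat m) → TValue (A ∷ B ∷ C ∷ []) 0 →
    (j : ℕ) → j < m →
    ((k : ℕ) → 1 ≤ k → k ≤ m ∸ j → (is : Fin k → ℕ) →
      (∀ p q → Data.Fin._<_ p q → is p < is q) → (∀ p → is p ≤ m ∸ 1 ∸ j) →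
      HasDim (λ v → ∀ l → InSpan (Vgens A B C (is l) j) v) (m ∸ k))
    ×
    countᵇ (λ v → allᵇ (λ i → not (inSpanᵇ (Vgens A B C i j) v)) (upTo (m ∸ j))) (allVecs m)
      ≡ 2 ^ j
lemma10 m A B C (net , _) j j<m = dimension , count-outside-all
  where
  open HyperplaneFamily A B C net j j<m
  index< : ∀ {i} → i ≤ m ∸ 1 ∸ j → i < m ∸ j
  index< {i} i≤ = subst (i <_) (sym (+-∸-assoc 1 j<m)) (s≤s (subst (i ≤_) (∸-+-assoc m 1 j) i≤))
  dimension : (k : ℕ) → 1 ≤ k → k ≤ m ∸ j → (is : Fin k → ℕ) →
              (∀ p q → Data.Fin._<_ p q → is p < is q) → (∀ p → is p ≤ m ∸ 1 ∸ j) →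
              HasDim (λ v → ∀ l → InSpan (Vgens A B C (is l) j) v) (m ∸ k)
  dimension k _ k≤n is increasing bounded = hasDim-InAll k is increasing (index< ∘ bounded) (≤-trans k≤n (m∸n≤m m j))
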